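{- Let $q$ be an odd prime power. Then: (1) For every integer $n\ge 0$, $S_{\mathbb{F}_q}^{\mathrm{adv}_n}=S_{\mathbb{F}_q}^{\mathrm{adv}_\infty}$ if and only if $S_{\mathbb{F}_q}^{\mathrm{back}_n}=S_{\mathbb{F}_q}^{\mathrm{back}_\infty}$. (2) For every integer $n\ge0$, $S_{\mathbb{F}_q}^{\mathrm{adv}_n}\cap S_{\mathbb{F}_q}^{\mathrm{back}_\infty}=S_{\mathbb{F}_q}^{\mathrm{cyc}}$ if and only if $S_{\mathbb{F}_q}^{\mathrm{back}_n}\cap S_{\mathbb{F}_q}^{\mathrm{adv}_\infty}=S_{\mathbb{F}_q}^{\mathrm{cyc}}$. (3) $\left|S_{\mathbb{F}_q}^{\mathrm{adv}_\infty}\right|=\left|S_{\mathbb{F}_q}^{\mathrm{back}_\infty}\right|$, and $\left|S_{\mathbb{F}_q}^{\mathrm{adv}_n}\right|=\left|S_{\mathbb{F}_q}^{\mathrm{back}_n}\right|$ for every $n\ge0$.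
   Context: Let $K$ be a field of characteristic not $2$. $S_K=\{(\alpha,\beta)\in K^2:\alpha,\beta,\alpha+\beta,\alpha-\beta\neq 0\}$. For $(\alpha,\beta),(\gamma,\delta)\in S_K$ write $(\alpha,\beta)\mapsto(\gamma,\delta)$ if $2\gamma=\alpha+\beta$ and $\delta^2=\alpha\beta$. For $n\ge0$, $S_K^{\mathrm{adv}_n}$ (resp. $S_K^{\mathrm{back}_n}$) is the set of $x_0\in S_K$ admitting $x_1,\dots,x_n\in S_K$ with $x_0\mapsto x_1\mapsto\cdots\mapsto x_n$ (resp. $x_{ -1},\dots,x_{ -n}\in S_K$ with $x_{ -n}\mapsto\cdots\mapsto x_{ -1}\mapsto x_0$); $S_K^{\mathrm{adv}_\infty}=\bigcap_n S_K^{\mathrm{adv}_n}$, $S_K^{\mathrm{back}_\infty}=\bigcap_n S_K^{\mathrm{back}_n}$, and $S_K^{\mathrm{cyc}}=S_K^{\mathrm{adv}_\infty}\cap S_K^{\mathrm{back}_\infty}$. -}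

module Defs where

open import Level using (0ℓ)
open import Data.Nat using (ℕ; zero; suc)
open import Data.Fin using (Fin)
open import Data.Product using (Σ; ∃; _×_; _,_)
open import Data.List using (List; length)
open import Data.List.Membership.Propositional using (_∈_)
open import Data.List.Relation.Unary.Unique.Propositional using (Unique)
open import Relation.Binary.PropositionalEquality using (_≡_; _≢_)
open import Relation.Nullary using (¬_)
open import Algebra.Structures using (IsCommutativeRing)
open import Function.Bundles using (_↔_; _⇔_)

record FiniteField (q : ℕ) : Set₁ where
  field
    Carrier : Set
    _+_ _*_ : Carrier → Carrier → Carrier
    -_      : Carrier → Carrier
    0# 1#   : Carrier
    isCommutativeRing : IsCommutativeRing _≡_ _+_ _*_ -_ 0# 1#
    0≢1     : 0# ≢ 1#
    inverse : ∀ x → x ≢ 0# → Σ Carrier λ y → x * y ≡ 1#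
    enum    : Carrier ↔ Fin q
  infixl 6 _+_
  infixl 7 _*_

module _ {q : ℕ} (F : FiniteField q) where
  open FiniteField F

  Pt : Set
  Pt = Carrier × Carrier

  InS : Pt → Set
  InS (α , β) = α ≢ 0# × β ≢ 0# × (α + β) ≢ 0# × (α + - β) ≢ 0#

  Step : Pt → Pt → Set
  Step (α , β) (γ , δ) =
    InS (α , β) × InS (γ , δ) × ((1# + 1#) * γ ≡ α + β) × (δ * δ ≡ α * β)

  AdvChain : ℕ → Pt → Set
  AdvChain zero    x = InS x
  AdvChain (suc n) x = Σ Pt λ y → Step x y × AdvChain n y

  BackChain : ℕ → Pt → Set
  BackChain zero    x = InS x
  BackChain (suc n) x = Σ Pt λ y → Step y x × BackChain n y

  Adv : ℕ → Pt → Set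
  Adv n x = InS x × AdvChain n x

  Back : ℕ → Pt → Set
  Back n x = InS x × BackChain n x

  AdvInf : Pt → Set
  AdvInf x = ∀ n → Adv n x

  BackInf : Pt → Set
  BackInf x = ∀ n → Back n x

  Cyc : Pt → Set
  Cyc x = AdvInf x × BackInf x

_≐_ : {A : Set} → (A → Set) → (A → Set) → Set
P ≐ Q = ∀ x → P x ⇔ Q x

HasSize : {A : Set} → (A → Set) → ℕ → Set
HasSize {A} P m = Σ (List A) λ xs → Unique xs × length xs ≡ m × (∀ x → P x ⇔ x ∈ xs)

SameSize : {A : Set} → (A → Set) → (A → Set) → Set
SameSize P Q = Σ ℕ λ m → HasSize P m × HasSize Q m

{-# OPTIONS --safe #-}

-- Write σ (a , b) = (a + b , a - b). If 2γ = α + β and δ² = αβ, then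
-- 2(α + β) = 2(γ + δ) + 2(γ - δ) and (α - β)² = (α + β)² - 4αβ = 4(γ + δ)(γ - δ),
-- so x ↦ y implies 2σ(y) ↦ σ(x); and ↦ is invariant under scaling by a
-- nonzero constant. As σ ∘ σ = 2, σ is a bijection of K² carrying chains
-- x₀ ↦ ⋯ ↦ xₙ to backward chains ending at σ(x₀), and conversely; so it maps
-- S^{adv_n} onto S^{back_n}, S^{back_n} onto S^{adv_n}, S^{adv_∞} onto
-- S^{back_∞} and S^{cyc} onto itself, which gives all three statements.
-- Counting needs S^{adv_∞} to be decidable: the decreasing sequence S^{adv_n}
-- of subsets of the finite set K² stalls at some m, and a chain condition that
-- is stable from m to m + 1 is stable from m on, so S^{adv_∞} = S^{adv_m}.

module Submission where

open import Defs
open import Level using (0ℓ)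
open import Algebra.Bundles using (CommutativeRing; RawRing)
open import Algebra.Structures using (IsCommutativeRing)
open import Data.Empty using (⊥-elim)
open import Data.Fin.Base using (Fin)
import Data.Fin.Properties as Fin
open import Data.List.Base using (List; map; filter; length; allFin)
open import Data.List.Properties using (length-map)
open import Data.List.Membership.Propositional using (_∈_; lose)
open import Data.List.Membership.Propositional.Properties
  using (∈-map⁺; ∈-map⁻; ∈-allFin; ∈-filter⁺; ∈-filter⁻)
open import Data.List.Relation.Binary.Pointwise using (Pointwise-≡⇒≡)
open import Data.List.Relation.Binary.Sublist.Propositional.Properties
  using (filter⁺; length-mono-≤; to-≋)
open import Data.List.Relation.Binary.Sublist.Propositional using (⊆-refl) renaming (_⊆_ to _⊑_)
open import Data.List.Relation.Unary.Any using (any?; satisfied)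
open import Data.List.Relation.Unary.Unique.Propositional using (Unique)
import Data.List.Relation.Unary.Unique.Propositional.Properties as Unique
open import Data.Maybe.Base using (Maybe; just; nothing)
open import Data.Nat.Base as ℕ using (ℕ; zero; suc; _≤_; _^_; _≥_)
import Data.Nat.Properties as ℕ
open import Data.Nat.Primality using (Prime)
open import Data.Product.Base using (∃; _×_; _,_; proj₁; proj₂)
open import Data.Product.Algebra using (×-comm)
open import Data.Product.Function.NonDependent.Propositional using (_×-↔_; _×-⇔_)
open import Data.Product.Properties using (≡-dec)
open import Function.Base using (_∘_; id)
open import Function.Bundles using (_⇔_; _↔_; mk⇔; mk↔ₛ′; Equivalence; Inverse; Injection)
open import Function.Construct.Composition using (_⇔-∘_)
open import Function.Construct.Symmetry using (⇔-sym)
open import Function.Properties.Equivalence using (⇔-setoid)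
open import Function.Properties.Inverse using (↔-refl; ↔-sym; ↔-trans; ↔⇒⇔; ↔⇒↣)
open import Relation.Binary.Definitions using (DecidableEquality)
open import Relation.Binary.PropositionalEquality
  using (_≡_; _≢_; refl; sym; trans; cong; cong₂; subst; module ≡-Reasoning)
open import Relation.Nullary using (¬_; Dec; yes; no)
open import Relation.Nullary.Decidable using (map′; ¬?; _×-dec_; via-injection)
open import Relation.Unary using (Decidable; _⊆_)

-- The library's solvers for rings with negation take their coefficients from
-- the ring itself, and these do not compute in an abstract ring.
module IntegerCoefficientSolver {c ℓ} (R : CommutativeRing c ℓ) where

  open CommutativeRing R
    using ( Carrier; _≈_; _+_; _*_; -_; _-_; 0#; 1#; setoid; reflexive
          ; +-cong; +-congˡ; +-congʳ; -‿cong; +-comm; +-identityˡ; +-identityʳ; -‿inverseʳ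
          ; ring; semiring; +-commutativeSemigroup)
    renaming (refl to ≈-refl; sym to ≈-sym; trans to ≈-trans)
  open import Algebra.Properties.Ring ring
    using (-‿+-comm; ⁻¹-anti-homo‿-; -0#≈0#; //-cong₂; [y-z]x≈yx-zx; x[y-z]≈xy-xz)
  open import Algebra.Properties.CommutativeSemigroup +-commutativeSemigroup
    using (interchange)
  open import Algebra.Properties.Semiring.Mult semiring
    using (×-homo-+; ×1-homo-*)
    renaming (_×_ to _·_)
  open import Algebra.Solver.Ring.AlmostCommutativeRing
    using (fromCommutativeRing; _-Raw-AlmostCommutative⟶_)
  open import Relation.Binary.Reasoning.Setoid setoid

  -- (m , n) stands for the integer m - n; normalise keeps one side zero so
  -- that equal integers have equal codes.
  normalise : ℕ → ℕ → ℕ × ℕ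
  normalise zero    n       = zero , n
  normalise (suc m) zero    = suc m , zero
  normalise (suc m) (suc n) = normalise m n

  integers : RawRing _ _
  integers = record
    { Carrier = ℕ × ℕ
    ; _≈_     = _≡_
    ; _+_     = λ { (a , b) (c , d) → normalise (a ℕ.+ c) (b ℕ.+ d) }
    ; _*_     = λ { (a , b) (c , d) → normalise (a ℕ.* c ℕ.+ b ℕ.* d) (a ℕ.* d ℕ.+ b ℕ.* c) }
    ; -_      = λ { (a , b) → b , a }
    ; 0#      = 0 , 0
    ; 1#      = 1 , 0
    }

  ⟦_⟧ : ℕ × ℕ → Carrier
  ⟦ m , n ⟧ = m · 1# - n · 1#

  [x+y]-[z+w]≈[x-z]+[y-w] : ∀ x y z w → (x + y) - (z + w) ≈ (x - z) + (y - w)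
  [x+y]-[z+w]≈[x-z]+[y-w] x y z w = begin
    (x + y) - (z + w)      ≈⟨ +-congˡ (-‿+-comm z w) ⟨
    (x + y) + (- z + - w)  ≈⟨ interchange x y (- z) (- w) ⟩
    (x - z) + (y - w)      ∎

  ⟦normalise⟧ : ∀ m n → ⟦ normalise m n ⟧ ≈ ⟦ m , n ⟧
  ⟦normalise⟧ zero    n       = ≈-refl
  ⟦normalise⟧ (suc m) zero    = ≈-refl
  ⟦normalise⟧ (suc m) (suc n) = begin
    ⟦ normalise m n ⟧                       ≈⟨ ⟦normalise⟧ m n ⟩
    m · 1# - n · 1#                         ≈⟨ +-identityˡ _ ⟨
    0# + (m · 1# - n · 1#)                  ≈⟨ +-congʳ (-‿inverseʳ 1#) ⟨
    (1# - 1#) + (m · 1# - n · 1#)           ≈⟨ [x+y]-[z+w]≈[x-z]+[y-w] 1# _ 1# _ ⟨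
    (1# + m · 1#) - (1# + n · 1#)           ∎

  +-homo : ∀ p q → ⟦ RawRing._+_ integers p q ⟧ ≈ ⟦ p ⟧ + ⟦ q ⟧
  +-homo (a , b) (c , d) = begin
    ⟦ normalise (a ℕ.+ c) (b ℕ.+ d) ⟧           ≈⟨ ⟦normalise⟧ (a ℕ.+ c) (b ℕ.+ d) ⟩
    (a ℕ.+ c) · 1# - (b ℕ.+ d) · 1#             ≈⟨ //-cong₂ (×-homo-+ 1# a c) (×-homo-+ 1# b d) ⟩
    (a · 1# + c · 1#) - (b · 1# + d · 1#)       ≈⟨ [x+y]-[z+w]≈[x-z]+[y-w] _ _ _ _ ⟩
    ⟦ a , b ⟧ + ⟦ c , d ⟧                       ∎

  *-homo : ∀ p q → ⟦ RawRing._*_ integers p q ⟧ ≈ ⟦ p ⟧ * ⟦ q ⟧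
  *-homo (a , b) (c , d) = begin
    ⟦ normalise (a ℕ.* c ℕ.+ b ℕ.* d) (a ℕ.* d ℕ.+ b ℕ.* c) ⟧
      ≈⟨ ⟦normalise⟧ (a ℕ.* c ℕ.+ b ℕ.* d) (a ℕ.* d ℕ.+ b ℕ.* c) ⟩
    (a ℕ.* c ℕ.+ b ℕ.* d) · 1# - (a ℕ.* d ℕ.+ b ℕ.* c) · 1#
      ≈⟨ //-cong₂ (·-homo-+* a c b d) (·-homo-+* a d b c) ⟩
    (A * C + B * D) - (A * D + B * C)
      ≈⟨ +-congˡ (-‿cong (+-comm _ _)) ⟩
    (A * C + B * D) - (B * C + A * D)
      ≈⟨ +-congˡ (-‿+-comm _ _) ⟨
    (A * C + B * D) + (- (B * C) + - (A * D))
      ≈⟨ interchange _ _ _ _ ⟩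
    (A * C - B * C) + (B * D - A * D)
      ≈⟨ +-congˡ (⁻¹-anti-homo‿- _ _) ⟨
    (A * C - B * C) - (A * D - B * D)
      ≈⟨ //-cong₂ ([y-z]x≈yx-zx C A B) ([y-z]x≈yx-zx D A B) ⟨
    (A - B) * C - (A - B) * D
      ≈⟨ x[y-z]≈xy-xz (A - B) C D ⟨
    (A - B) * (C - D) ∎
    where
    A B C D : Carrier
    A = a · 1#
    B = b · 1#
    C = c · 1#
    D = d · 1#

    ·-homo-+* : ∀ a c b d → (a ℕ.* c ℕ.+ b ℕ.* d) · 1# ≈ (a · 1#) * (c · 1#) + (b · 1#) * (d · 1#)
    ·-homo-+* a c b d =
      ≈-trans (×-homo-+ 1# (a ℕ.* c) (b ℕ.* d)) (+-cong (×1-homo-* a c) (×1-homo-* b d))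

  homomorphism : integers -Raw-AlmostCommutative⟶ fromCommutativeRing R
  homomorphism = record
    { ⟦_⟧    = ⟦_⟧
    ; +-homo = +-homo
    ; *-homo = *-homo
    ; -‿homo = λ { (a , b) → ≈-sym (⁻¹-anti-homo‿- (a · 1#) (b · 1#)) }
    ; 0-homo = -‿inverseʳ 0#
    ; 1-homo = ≈-trans (+-cong (+-identityʳ 1#) -0#≈0#) (+-identityʳ 1#)
    }

  equal? : ∀ p q → Maybe (⟦ p ⟧ ≈ ⟦ q ⟧)
  equal? p q with ≡-dec ℕ._≟_ ℕ._≟_ p q
  ... | yes p≡q = just (reflexive (cong ⟦_⟧ p≡q))
  ... | no _    = nothing

  open import Algebra.Solver.Ring integers (fromCommutativeRing R) homomorphism equal? public
    using (solve; _:+_; _:-_; _:*_; _:=_)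

decreasing⇒stalls : (f : ℕ → ℕ) → (∀ n → f (suc n) ≤ f n) → ∃ λ m → f (suc m) ≡ f m
decreasing⇒stalls f f-decr = bounded (f 0) f f-decr ℕ.≤-refl
  where
  bounded : ∀ b (f : ℕ → ℕ) → (∀ n → f (suc n) ≤ f n) → f 0 ≤ b → ∃ λ m → f (suc m) ≡ f m
  bounded b f f-decr f0≤b with f 1 ℕ.≟ f 0
  ... | yes f1≡f0 = 0 , f1≡f0
  ... | no  f1≢f0 with b | ℕ.<-≤-trans (ℕ.≤∧≢⇒< (f-decr 0) f1≢f0) f0≤b
  ...   | zero   | ()
  ...   | suc b′ | f1<1+b′ =
          let m , stalls = bounded b′ (f ∘ suc) (f-decr ∘ suc) (ℕ.s≤s⁻¹ f1<1+b′) in suc m , stalls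

∀-⇔ : {P Q : ℕ → Set} → (∀ n → P n ⇔ Q n) → (∀ n → P n) ⇔ (∀ n → Q n)
∀-⇔ P⇔Q = mk⇔ (λ P n → Equivalence.to (P⇔Q n) (P n)) (λ Q n → Equivalence.from (P⇔Q n) (Q n))

module _ {A B : Set} (f : A ↔ B) where

  open Inverse f

  ≐-transport : {P P′ : A → Set} {Q Q′ : B → Set} →
    (∀ x → P x ⇔ Q (to x)) → (∀ x → P′ x ⇔ Q′ (to x)) → (P ≐ P′) ⇔ (Q ≐ Q′)
  ≐-transport {P} {P′} {Q} {Q′} P⇔Q P′⇔Q′ = mk⇔ forward backward
    where
    open import Relation.Binary.Reasoning.Setoid (⇔-setoid 0ℓ)

    forward : P ≐ P′ → Q ≐ Q′
    forward P≐P′ y = begin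
      Q y               ≡⟨ cong Q (strictlyInverseˡ y) ⟨
      Q (to (from y))   ≈⟨ P⇔Q (from y) ⟨
      P (from y)        ≈⟨ P≐P′ (from y) ⟩
      P′ (from y)       ≈⟨ P′⇔Q′ (from y) ⟩
      Q′ (to (from y))  ≡⟨ cong Q′ (strictlyInverseˡ y) ⟩
      Q′ y              ∎

    backward : Q ≐ Q′ → P ≐ P′
    backward Q≐Q′ x = begin
      P x         ≈⟨ P⇔Q x ⟩
      Q (to x)    ≈⟨ Q≐Q′ (to x) ⟩
      Q′ (to x)   ≈⟨ P′⇔Q′ x ⟨
      P′ x        ∎

  HasSize-transport : {P : A → Set} {Q : B → Set} {m : ℕ} →
    (∀ x → P x ⇔ Q (to x)) → HasSize P m → HasSize Q m
  HasSize-transport {P} {Q} P⇔Q (xs , unique , refl , P⇔∈) =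
    map to xs , Unique.map⁺ (Injection.injective (↔⇒↣ f)) unique , length-map to xs ,
    λ y → mk⇔ (Q⇒∈ y) ∈⇒Q
    where
    Q⇒∈ : ∀ y → Q y → y ∈ map to xs
    Q⇒∈ y Qy = subst (_∈ map to xs) (strictlyInverseˡ y)
      (∈-map⁺ to (Equivalence.to (P⇔∈ (from y))
        (Equivalence.from (P⇔Q (from y)) (subst Q (sym (strictlyInverseˡ y)) Qy))))

    ∈⇒Q : ∀ {y} → y ∈ map to xs → Q y
    ∈⇒Q y∈ with x , x∈xs , refl ← ∈-map⁻ to y∈ =
      Equivalence.to (P⇔Q x) (Equivalence.from (P⇔∈ x) x∈xs)

SameSize-transport : {A : Set} {P Q : A → Set} (f : A ↔ A) →
  (∀ x → P x ⇔ Q (Inverse.to f x)) → ∃ (HasSize P) → SameSize P Q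
SameSize-transport f P⇔Q (m , P-size) = m , P-size , HasSize-transport f P⇔Q P-size

module FiniteType {A : Set} {k : ℕ} (enum : A ↔ Fin k) where

  open Inverse enum

  elements : List A
  elements = map from (allFin k)

  ∈-elements : ∀ x → x ∈ elements
  ∈-elements x = subst (_∈ elements) (strictlyInverseʳ x) (∈-map⁺ from (∈-allFin (to x)))

  elements-unique : Unique elements
  elements-unique = Unique.map⁺ (Injection.injective (↔⇒↣ (↔-sym enum))) (Unique.allFin⁺ k)

  infix 4 _≟_
  _≟_ : DecidableEquality A
  _≟_ = via-injection (↔⇒↣ enum) Fin._≟_

  ∃? : {P : A → Set} → Decidable P → Dec (∃ P)
  ∃? P? = map′ satisfied (λ (x , Px) → lose (∈-elements x) Px) (any? P? elements)

  hasSize : {P : A → Set} → Decidable P → ∃ (HasSize P)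
  hasSize P? = length xs , xs , Unique.filter⁺ P? elements-unique , refl ,
    λ x → mk⇔ (∈-filter⁺ P? (∈-elements x)) (proj₂ ∘ ∈-filter⁻ P? {xs = elements})
    where xs = filter P? elements

  module _ {C : ℕ → A → Set} (C? : ∀ n → Decidable (C n)) (C-decr : ∀ n → C (suc n) ⊆ C n) where

    private
      filtered : ℕ → List A
      filtered n = filter (C? n) elements

      filtered-decr : ∀ n → filtered (suc n) ⊑ filtered n
      filtered-decr n = filter⁺ (C? (suc n)) (C? n) (λ { refl → C-decr n }) (⊆-refl {x = elements})

    decreasing-stabilises : ∃ λ m → C m ⊆ C (suc m)
    decreasing-stabilises
      with m , same-length ← decreasing⇒stalls (length ∘ filtered) (length-mono-≤ ∘ filtered-decr)
      = m , λ {x} Cx → proj₂ (∈-filter⁻ (C? (suc m)) {xs = elements}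
              (subst (x ∈_) filtered-stalls (∈-filter⁺ (C? m) (∈-elements x) Cx)))
      where
      filtered-stalls : filtered m ≡ filtered (suc m)
      filtered-stalls = sym (Pointwise-≡⇒≡ (to-≋ same-length (filtered-decr m)))

module _ {q : ℕ} (F : FiniteField q) where

  open FiniteField F
  open IsCommutativeRing isCommutativeRing
    using (zeroˡ; zeroʳ; distribˡ; distribʳ; *-assoc; *-comm; *-identityˡ; *-identityʳ)

  commutativeRing : CommutativeRing 0ℓ 0ℓ
  commutativeRing = record { isCommutativeRing = isCommutativeRing }

  open import Algebra.Properties.Ring (CommutativeRing.ring commutativeRing)
    using (x[y-z]≈xy-xz)
  open IntegerCoefficientSolver commutativeRing using (solve; _:+_; _:-_; _:*_; _:=_)
  open FiniteType enum using (_≟_)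
  open ≡-Reasoning

  ≢0-resp : ∀ {x y} → x ≡ y → y ≢ 0# → x ≢ 0#
  ≢0-resp x≡y y≢0 x≡0 = y≢0 (trans (sym x≡y) x≡0)

  x≢0∧y≢0⇒x*y≢0 : ∀ {x y} → x ≢ 0# → y ≢ 0# → x * y ≢ 0#
  x≢0∧y≢0⇒x*y≢0 {x} {y} x≢0 y≢0 xy≡0 with y⁻¹ , yy⁻¹≡1 ← inverse y y≢0 = x≢0 (begin
    x               ≡⟨ *-identityʳ x ⟨
    x * 1#          ≡⟨ cong (x *_) yy⁻¹≡1 ⟨
    x * (y * y⁻¹)   ≡⟨ *-assoc x y y⁻¹ ⟨
    (x * y) * y⁻¹   ≡⟨ cong (_* y⁻¹) xy≡0 ⟩
    0# * y⁻¹        ≡⟨ zeroˡ y⁻¹ ⟩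
    0#              ∎)

  two : Carrier
  two = 1# + 1#

  two*x≡x+x : ∀ x → two * x ≡ x + x
  two*x≡x+x x = trans (distribʳ x 1# 1#) (cong₂ _+_ (*-identityˡ x) (*-identityˡ x))

  _∙_ : Carrier → Pt F → Pt F
  c ∙ (a , b) = c * a , c * b

  σ : Pt F → Pt F
  σ (a , b) = a + b , a + - b

  ∙-assoc : ∀ c d x → c ∙ (d ∙ x) ≡ (c * d) ∙ x
  ∙-assoc c d (a , b) = cong₂ _,_ (sym (*-assoc c d a)) (sym (*-assoc c d b))

  σ-∙ : ∀ c x → σ (c ∙ x) ≡ c ∙ σ x
  σ-∙ c (a , b) = cong₂ _,_ (sym (distribˡ c a b)) (sym (x[y-z]≈xy-xz c a b))

  σ-σ : ∀ x → σ (σ x) ≡ two ∙ x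
  σ-σ (a , b) = cong₂ _,_
    (trans (solve 2 (λ a b → (a :+ b) :+ (a :- b) := a :+ a) refl a b) (sym (two*x≡x+x a)))
    (trans (solve 2 (λ a b → (a :+ b) :- (a :- b) := b :+ b) refl a b) (sym (two*x≡x+x b)))

  -- InS x says that the coordinates of x and of σ x are nonzero.
  InS-∙ : ∀ {c} x → c ≢ 0# → InS F x → InS F (c ∙ x)
  InS-∙ {c} (a , b) c≢0 (a≢0 , b≢0 , a+b≢0 , a-b≢0) =
    x≢0∧y≢0⇒x*y≢0 c≢0 a≢0 , x≢0∧y≢0⇒x*y≢0 c≢0 b≢0 ,
    ≢0-resp (cong proj₁ (σ-∙ c (a , b))) (x≢0∧y≢0⇒x*y≢0 c≢0 a+b≢0) ,
    ≢0-resp (cong proj₂ (σ-∙ c (a , b))) (x≢0∧y≢0⇒x*y≢0 c≢0 a-b≢0)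

  InS-σ : two ≢ 0# → ∀ x → InS F x → InS F (σ x)
  InS-σ two≢0 (a , b) (a≢0 , b≢0 , a+b≢0 , a-b≢0) =
    a+b≢0 , a-b≢0 ,
    ≢0-resp (cong proj₁ (σ-σ (a , b))) (x≢0∧y≢0⇒x*y≢0 two≢0 a≢0) ,
    ≢0-resp (cong proj₂ (σ-σ (a , b))) (x≢0∧y≢0⇒x*y≢0 two≢0 b≢0)

  *-square-∙ : ∀ c {α β δ} → δ * δ ≡ α * β → (c * δ) * (c * δ) ≡ (c * α) * (c * β)
  *-square-∙ c {α} {β} {δ} δ²≡αβ = begin
    (c * δ) * (c * δ)  ≡⟨ solve 2 (λ c δ → (c :* δ) :* (c :* δ) := (c :* c) :* (δ :* δ)) refl c δ ⟩
    (c * c) * (δ * δ)  ≡⟨ cong ((c * c) *_) δ²≡αβ ⟩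
    (c * c) * (α * β)
      ≡⟨ solve 3 (λ c α β → (c :* c) :* (α :* β) := (c :* α) :* (c :* β)) refl c α β ⟩
    (c * α) * (c * β)  ∎

  Step-∙ : ∀ {c x y} → c ≢ 0# → Step F x y → Step F (c ∙ x) (c ∙ y)
  Step-∙ {c} {α , β} {γ , δ} c≢0 (Sx , Sy , 2γ≡α+β , δ²≡αβ) =
    InS-∙ _ c≢0 Sx , InS-∙ _ c≢0 Sy , 2cγ≡cα+cβ , *-square-∙ c δ²≡αβ
    where
    2cγ≡cα+cβ : two * (c * γ) ≡ c * α + c * β
    2cγ≡cα+cβ = begin
      two * (c * γ)  ≡⟨ solve 3 (λ t c γ → t :* (c :* γ) := c :* (t :* γ)) refl two c γ ⟩
      c * (two * γ)  ≡⟨ cong (c *_) 2γ≡α+β ⟩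
      c * (α + β)    ≡⟨ distribˡ c α β ⟩
      c * α + c * β  ∎

  Step-σ : two ≢ 0# → ∀ {x y} → Step F x y → Step F (two ∙ σ y) (σ x)
  Step-σ two≢0 {α , β} {γ , δ} (Sx , Sy , 2γ≡α+β , δ²≡αβ) =
    InS-∙ _ two≢0 (InS-σ two≢0 _ Sy) , InS-σ two≢0 _ Sx , sum , square
    where
    sum : two * (α + β) ≡ two * (γ + δ) + two * (γ + - δ)
    sum = begin
      two * (α + β)                    ≡⟨ cong (two *_) 2γ≡α+β ⟨
      two * (two * γ)                  ≡⟨ cong (λ p → two * proj₁ p) (σ-σ (γ , δ)) ⟨
      two * ((γ + δ) + (γ + - δ))      ≡⟨ distribˡ two (γ + δ) (γ + - δ) ⟩
      two * (γ + δ) + two * (γ + - δ)  ∎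

    square : (α + - β) * (α + - β) ≡ (two * (γ + δ)) * (two * (γ + - δ))
    square = begin
      (α + - β) * (α + - β)
        ≡⟨ solve 2 (λ α β → (α :- β) :* (α :- β)
                    := (α :+ β) :* (α :+ β) :- ((α :+ β) :+ (α :- β)) :* ((α :+ β) :- (α :- β)))
                 refl α β ⟩
      (α + β) * (α + β) + - (((α + β) + (α + - β)) * ((α + β) + - (α + - β)))
        ≡⟨ cong (λ p → (α + β) * (α + β) + - (proj₁ p * proj₂ p)) (σ-σ (α , β)) ⟩
      (α + β) * (α + β) + - ((two * α) * (two * β))
        ≡⟨ cong₂ (λ s p → s * s + - p) (sym 2γ≡α+β) (sym (*-square-∙ two δ²≡αβ)) ⟩
      (two * γ) * (two * γ) + - ((two * δ) * (two * δ))
        ≡⟨ solve 3 (λ t γ δ → (t :* γ) :* (t :* γ) :- (t :* δ) :* (t :* δ)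
                      := (t :* (γ :+ δ)) :* (t :* (γ :- δ)))
                 refl two γ δ ⟩
      (two * (γ + δ)) * (two * (γ + - δ))  ∎

  AdvChain-∙ : ∀ {c} → c ≢ 0# → ∀ n {x} → AdvChain F n x → AdvChain F n (c ∙ x)
  AdvChain-∙ c≢0 zero    Sx             = InS-∙ _ c≢0 Sx
  AdvChain-∙ c≢0 (suc n) (y , x↦y , ch) = _ , Step-∙ c≢0 x↦y , AdvChain-∙ c≢0 n ch

  BackChain-∙ : ∀ {c} → c ≢ 0# → ∀ n {x} → BackChain F n x → BackChain F n (c ∙ x)
  BackChain-∙ c≢0 zero    Sx             = InS-∙ _ c≢0 Sx
  BackChain-∙ c≢0 (suc n) (y , y↦x , ch) = _ , Step-∙ c≢0 y↦x , BackChain-∙ c≢0 n ch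

  Adv-∙ : ∀ {c} → c ≢ 0# → ∀ n {x} → Adv F n x → Adv F n (c ∙ x)
  Adv-∙ c≢0 n (Sx , ch) = InS-∙ _ c≢0 Sx , AdvChain-∙ c≢0 n ch

  Back-∙ : ∀ {c} → c ≢ 0# → ∀ n {x} → Back F n x → Back F n (c ∙ x)
  Back-∙ c≢0 n (Sx , ch) = InS-∙ _ c≢0 Sx , BackChain-∙ c≢0 n ch

  module OddCharacteristic (two≢0 : two ≢ 0#) where

    half : Carrier
    half = proj₁ (inverse two two≢0)

    half≢0 : half ≢ 0#
    half≢0 half≡0 = 0≢1 (begin
      0#           ≡⟨ zeroʳ two ⟨
      two * 0#     ≡⟨ cong (two *_) half≡0 ⟨
      two * half   ≡⟨ proj₂ (inverse two two≢0) ⟩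
      1#           ∎)

    half∙two∙x≡x : ∀ x → half ∙ (two ∙ x) ≡ x
    half∙two∙x≡x x = begin
      half ∙ (two ∙ x)   ≡⟨ ∙-assoc half two x ⟩
      (half * two) ∙ x   ≡⟨ cong (_∙ x) (trans (*-comm half two) (proj₂ (inverse two two≢0))) ⟩
      1# ∙ x             ≡⟨ cong₂ _,_ (*-identityˡ (proj₁ x)) (*-identityˡ (proj₂ x)) ⟩
      x                  ∎

    σ⁻¹ : Pt F → Pt F
    σ⁻¹ x = half ∙ σ x

    σ⁻¹-σ : ∀ x → σ⁻¹ (σ x) ≡ x
    σ⁻¹-σ x = trans (cong (half ∙_) (σ-σ x)) (half∙two∙x≡x x)

    σ-σ⁻¹ : ∀ x → σ (σ⁻¹ x) ≡ x
    σ-σ⁻¹ x = trans (σ-∙ half (σ x)) (σ⁻¹-σ x)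

    σ-↔ : Pt F ↔ Pt F
    σ-↔ = mk↔ₛ′ σ σ⁻¹ σ-σ⁻¹ σ⁻¹-σ

    AdvChain⇒BackChain-σ : ∀ n {x} → AdvChain F n x → BackChain F n (σ x)
    AdvChain⇒BackChain-σ zero Sx = InS-σ two≢0 _ Sx
    AdvChain⇒BackChain-σ (suc n) (y , x↦y , ch) =
      two ∙ σ y , Step-σ two≢0 x↦y , BackChain-∙ two≢0 n (AdvChain⇒BackChain-σ n ch)

    BackChain⇒AdvChain-σ : ∀ n {x} → BackChain F n x → AdvChain F n (σ x)
    BackChain⇒AdvChain-σ zero Sx = InS-σ two≢0 _ Sx
    BackChain⇒AdvChain-σ (suc n) {x} (y , y↦x , ch) =
      σ⁻¹ y , σx↦σ⁻¹y , AdvChain-∙ half≢0 n (BackChain⇒AdvChain-σ n ch)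
      where
      σx↦σ⁻¹y : Step F (σ x) (σ⁻¹ y)
      σx↦σ⁻¹y = subst (λ z → Step F z (σ⁻¹ y)) (half∙two∙x≡x (σ x))
                       (Step-∙ half≢0 (Step-σ two≢0 y↦x))

    Adv⇒Back-σ : ∀ n {x} → Adv F n x → Back F n (σ x)
    Adv⇒Back-σ n (Sx , ch) = InS-σ two≢0 _ Sx , AdvChain⇒BackChain-σ n ch

    Back⇒Adv-σ : ∀ n {x} → Back F n x → Adv F n (σ x)
    Back⇒Adv-σ n (Sx , ch) = InS-σ two≢0 _ Sx , BackChain⇒AdvChain-σ n ch

    Adv⇔Back-σ : ∀ n x → Adv F n x ⇔ Back F n (σ x)
    Adv⇔Back-σ n x =
      mk⇔ (Adv⇒Back-σ n) (subst (Adv F n) (σ⁻¹-σ x) ∘ Adv-∙ half≢0 n ∘ Back⇒Adv-σ n)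

    Back⇔Adv-σ : ∀ n x → Back F n x ⇔ Adv F n (σ x)
    Back⇔Adv-σ n x =
      mk⇔ (Back⇒Adv-σ n) (subst (Back F n) (σ⁻¹-σ x) ∘ Back-∙ half≢0 n ∘ Adv⇒Back-σ n)

  module EvenCharacteristic (two≡0 : two ≡ 0#) where

    ¬Step : ∀ {x y} → ¬ Step F x y
    ¬Step {α , β} {γ , _} ((_ , _ , α+β≢0 , _) , _ , 2γ≡α+β , _) = α+β≢0 (begin
      α + β     ≡⟨ 2γ≡α+β ⟨
      two * γ   ≡⟨ cong (_* γ) two≡0 ⟩
      0# * γ    ≡⟨ zeroˡ γ ⟩
      0#        ∎)

    Adv⇔Back : ∀ n x → Adv F n x ⇔ Back F n x
    Adv⇔Back zero    x = mk⇔ id id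
    Adv⇔Back (suc n) x = mk⇔ (λ (_ , _ , x↦y , _) → ⊥-elim (¬Step x↦y))
                              (λ (_ , _ , y↦x , _) → ⊥-elim (¬Step y↦x))

  record Duality : Set where
    field
      τ        : Pt F ↔ Pt F
      Adv⇔Back : ∀ n x → Adv F n x ⇔ Back F n (Inverse.to τ x)
      Back⇔Adv : ∀ n x → Back F n x ⇔ Adv F n (Inverse.to τ x)

  -- No hypothesis on q is needed: when 2 = 0 there are no steps at all,
  -- so Adv n = Back n and the identity is a duality.
  duality : Duality
  duality with two ≟ 0#
  ... | no two≢0 = record { τ = σ-↔ ; Adv⇔Back = Adv⇔Back-σ ; Back⇔Adv = Back⇔Adv-σ }
    where open OddCharacteristic two≢0
  ... | yes two≡0 =
    record { τ = ↔-refl ; Adv⇔Back = Adv⇔Back ; Back⇔Adv = λ n x → ⇔-sym (Adv⇔Back n x) }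
    where open EvenCharacteristic two≡0

  open Duality duality

  AdvInf⇔BackInf : ∀ x → AdvInf F x ⇔ BackInf F (Inverse.to τ x)
  AdvInf⇔BackInf x = ∀-⇔ (λ n → Adv⇔Back n x)

  BackInf⇔AdvInf : ∀ x → BackInf F x ⇔ AdvInf F (Inverse.to τ x)
  BackInf⇔AdvInf x = ∀-⇔ (λ n → Back⇔Adv n x)

  Cyc⇔Cyc : ∀ x → Cyc F x ⇔ Cyc F (Inverse.to τ x)
  Cyc⇔Cyc x = ↔⇒⇔ (×-comm _ _) ⇔-∘ (AdvInf⇔BackInf x ×-⇔ BackInf⇔AdvInf x)

  Pt-enum : Pt F ↔ Fin (q ℕ.* q)
  Pt-enum = ↔-trans (enum ×-↔ enum) (↔-sym Fin.*↔×)

  open FiniteType Pt-enum using (∃?; decreasing-stabilises)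

  InS? : Decidable (InS F)
  InS? (a , b) = ¬? (a ≟ 0#) ×-dec ¬? (b ≟ 0#) ×-dec ¬? (a + b ≟ 0#) ×-dec ¬? (a + - b ≟ 0#)

  Step? : ∀ x y → Dec (Step F x y)
  Step? (α , β) (γ , δ) =
    InS? (α , β) ×-dec InS? (γ , δ) ×-dec (two * γ ≟ α + β) ×-dec (δ * δ ≟ α * β)

  AdvChain? : ∀ n → Decidable (AdvChain F n)
  AdvChain? zero    = InS?
  AdvChain? (suc n) x = ∃? (λ y → Step? x y ×-dec AdvChain? n y)

  Adv? : ∀ n → Decidable (Adv F n)
  Adv? n x = InS? x ×-dec AdvChain? n x

  AdvChain⇒InS : ∀ n → AdvChain F n ⊆ InS F
  AdvChain⇒InS zero    Sx                  = Sx
  AdvChain⇒InS (suc n) (_ , (Sx , _) , _) = Sx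

  AdvChain-antitone : ∀ n → AdvChain F (suc n) ⊆ AdvChain F n
  AdvChain-antitone zero    (_ , (Sx , _) , _)  = Sx
  AdvChain-antitone (suc n) (y , x↦y , ch)      = y , x↦y , AdvChain-antitone n ch

  AdvChain-truncate : ∀ n k → AdvChain F (n ℕ.+ k) ⊆ AdvChain F n
  AdvChain-truncate zero    k ch                 = AdvChain⇒InS k ch
  AdvChain-truncate (suc n) k (y , x↦y , ch)     = y , x↦y , AdvChain-truncate n k ch

  AdvChain-stable : ∀ {m} → AdvChain F m ⊆ AdvChain F (suc m) → ∀ n → AdvChain F m ⊆ AdvChain F n
  AdvChain-stable {m} grow n = AdvChain-truncate n m ∘ lift n
    where
    grow-+ : ∀ k → AdvChain F (k ℕ.+ m) ⊆ AdvChain F (suc k ℕ.+ m)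
    grow-+ zero    = grow
    grow-+ (suc k) (y , x↦y , ch) = y , x↦y , grow-+ k ch

    lift : ∀ k → AdvChain F m ⊆ AdvChain F (k ℕ.+ m)
    lift zero    = id
    lift (suc k) = grow-+ k ∘ lift k

  AdvInf? : Decidable (AdvInf F)
  AdvInf? x with m , grow ← decreasing-stabilises AdvChain? AdvChain-antitone =
    map′ (λ (Sx , ch) n → Sx , AdvChain-stable grow n ch) (λ inf → inf m) (Adv? m x)

theorem1p5 : (q p k : ℕ) → Prime p → p ≢ 2 → k ≥ 1 → q ≡ p ^ k →
    (F : FiniteField q) →
      ((n : ℕ) → (Adv F n ≐ AdvInf F) ⇔ (Back F n ≐ BackInf F))
    × ((n : ℕ) → ((λ x → Adv F n x × BackInf F x) ≐ Cyc F)
                 ⇔ ((λ x → Back F n x × AdvInf F x) ≐ Cyc F))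
    × SameSize (AdvInf F) (BackInf F)
    × ((n : ℕ) → SameSize (Adv F n) (Back F n))
theorem1p5 _ _ _ _ _ _ _ F =
    (λ n → ≐-transport τ (Adv⇔Back n) (AdvInf⇔BackInf F))
  , (λ n → ≐-transport τ (λ x → Adv⇔Back n x ×-⇔ BackInf⇔AdvInf F x) (Cyc⇔Cyc F))
  , SameSize-transport τ (AdvInf⇔BackInf F) (hasSize (AdvInf? F))
  , (λ n → SameSize-transport τ (Adv⇔Back n) (hasSize (Adv? F n)))
  where
  open Duality (duality F)
  open FiniteType (Pt-enum F) using (hasSize)
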